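{- Let $I\subset\widehat{\mathfrak{h}}^1_*$ be a closed ideal. Then there exist $\alpha_1,\alpha_2,\ldots\in I$ with $\alpha_n\to0$ such that $I$ is the closure of the ideal generated by $\alpha_1,\alpha_2,\ldots$.
   Context: A composition is a finite ordered tuple $\mathbf{s}=(s_1,\ldots,s_k)$ of positive integers (the empty composition allowed), of weight $w(\mathbf{s})=s_1+\cdots+s_k$. $\widehat{\mathfrak{h}}^1$ is the $\mathbb{Q}$-vector space of formal infinite sums $\sum_{\mathbf{s}}\alpha_{\mathbf{s}}z_{\mathbf{s}}$, $\alpha_{\mathbf{s}}\in\mathbb{Q}$, over all compositions, where $z_{\mathbf{s}}=z_{s_1}\cdots z_{s_k}$ are words in noncommuting symbols $z_1,z_2,\ldots$ ($z_\varnothing=1$). Let $I_n$ be the subspace of sums with $\alpha_{\mathbf{s}}=0$ whenever $w(\mathbf{s})<n$; the $I_n$ form a neighborhood basis of $0$. The harmonic (stuffle) product $*$ is defined on words by $1*\alpha=\alpha*1=\alpha$ and $(z_{a}u)*(z_{b}v)=z_a(u*(z_bv))+z_b((z_au)*v)+z_{a+b}(u*v)$, extended bilinearly and continuously; $\widehat{\mathfrak{h}}^1_*$ denotes $\widehat{\mathfrak{h}}^1$ as a commutative topological ring under $*$ (isomorphic to the degree-completion of the ring of quasi-symmetric functions over $\mathbb{Q}$). The $I_n$ are ideals of it. -}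

module Defs where

open import Data.Nat as ℕ using (ℕ; zero; suc; _≤_; _<_)
open import Data.Integer using (+_)
open import Data.List using (List; []; _∷_; [_]; map; _++_; concatMap; foldr; upTo; length; filter)
open import Data.List.Properties using (≡-dec)
open import Data.Product using (Σ; ∃; _×_; _,_)
open import Data.Rational using (ℚ; 0ℚ; _/_) renaming (_+_ to _+ℚ_; _*_ to _*ℚ_; _-_ to _-ℚ_)
open import Relation.Binary.PropositionalEquality using (_≡_)
open import Relation.Nullary using (Dec)
open import Data.Product using (proj₁; proj₂)

-- A composition (s₁,…,s_k) of positive integers is encoded as the list
-- (s₁ - 1, …, s_k - 1) of naturals: an entry k stands for the part k+1.
Comp : Set
Comp = List ℕ

weight : Comp → ℕ
weight = foldr (λ k n → suc k ℕ.+ n) 0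

incHead : Comp → List Comp
incHead []      = []
incHead (k ∷ s) = [ suc k ∷ s ]

comps : ℕ → List Comp
comps zero    = [ [] ]
comps (suc n) = map (0 ∷_) (comps n) ++ concatMap incHead (comps n)

-- the stuffle product of two words, as the list (multiset) of words
-- appearing with multiplicity; part (a+1)+(b+1) = (a+b+1)+1
stuffle : Comp → Comp → List Comp
stuffle []      v       = [ v ]
stuffle (a ∷ u) []      = [ a ∷ u ]
stuffle (a ∷ u) (b ∷ v) =
  map (a ∷_) (stuffle u (b ∷ v)) ++ map (b ∷_) (stuffle (a ∷ u) v)
  ++ map (suc (a ℕ.+ b) ∷_) (stuffle u v)

_≟C_ : (s t : Comp) → Dec (s ≡ t)
_≟C_ = ≡-dec ℕ._≟_

count : Comp → List Comp → ℕ
count s ws = length (filter (λ t → t ≟C s) ws)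

-- the ring ĥ¹ : formal series Σ α_s z_s, i.e. coefficient functions
H : Set
H = Comp → ℚ

ℕtoℚ : ℕ → ℚ
ℕtoℚ n = + n / 1

sumℚ : List ℚ → ℚ
sumℚ = foldr _+ℚ_ 0ℚ

pairsOfWeight : ℕ → List (Comp × Comp)
pairsOfWeight n =
  concatMap (λ k → concatMap (λ u → map (λ v → u , v) (comps (n ℕ.∸ k))) (comps k))
            (upTo (suc n))

zeroH : H
zeroH _ = 0ℚ

_+H_ : H → H → H
(x +H y) s = x s +ℚ y s

_-H_ : H → H → H
(x -H y) s = x s -ℚ y s

-- harmonic (stuffle) product: coefficient of z_s in x * y
-- (the stuffle is weight-homogeneous, so only pairs with w(u)+w(v)=w(s) contribute)
_*H_ : H → H → H
(x *H y) s = sumℚ (map (λ p → let u = proj₁ p ; v = proj₂ p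
                              in x u *ℚ y v *ℚ ℕtoℚ (count s (stuffle u v)))
                       (pairsOfWeight (weight s)))

InI : ℕ → H → Set
InI n x = ∀ s → weight s < n → x s ≡ 0ℚ

Closure : (H → Set) → H → Set
Closure J x = ∀ n → ∃ λ y → J y × InI n (x -H y)

record IsIdeal (I : H → Set) : Set where
  field
    zero∈ : I zeroH
    +∈    : ∀ {x y} → I x → I y → I (x +H y)
    *∈    : ∀ r {x} → I x → I (r *H x)

IsClosed : (H → Set) → Set
IsClosed I = ∀ x → Closure I x → I x

IsClosedIdeal : (H → Set) → Set
IsClosedIdeal I = IsIdeal I × IsClosed I

data Gen (α : ℕ → H) : H → Set where
  gen  : ∀ i → Gen α (α i)
  zer  : Gen α zeroH
  add  : ∀ {x y} → Gen α x → Gen α y → Gen α (x +H y)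
  mul  : ∀ r {x} → Gen α x → Gen α (r *H x)

TendsToZero : (ℕ → H) → Set
TendsToZero α = ∀ N → ∃ λ M → ∀ n → M ≤ n → InI N (α n)

-- Enumerate all compositions as e₀, e₁, … in order of weight and run Gaussian elimination
-- along this enumeration: α_j is an element of I vanishing at e₀, …, e_{j-1} and not at e_j,
-- if one exists (decided by excluded middle), and 0 otherwise. Every x ∈ I is then reduced
-- step by step: after j steps x = y + z with y in the ideal generated by the α's and z ∈ I
-- vanishing at e₀, …, e_{j-1}; the only scalars needed are constant series, which multiply
-- coefficientwise. Since the compositions of weight < N are among the first finitely many
-- e_i, this shows x lies in the closure of the generated ideal, and also that α_n → 0.
module Submission where

open import Defs
open import Level using (0ℓ)
open import Axiom.ExcludedMiddle using (ExcludedMiddle)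
open import Data.Nat as ℕ using (ℕ; zero; suc; _≤_; _<_; z≤n; s≤s; _∸_)
import Data.Nat.Properties as ℕ
open import Data.List using (List; []; _∷_; [_]; map; _++_; concatMap; applyUpTo; length; filter)
import Data.List.Properties as List
open import Data.List.Membership.Propositional using (_∈_)
open import Data.List.Membership.Propositional.Properties using (∈-++⁺ˡ; ∈-++⁺ʳ)
open import Data.List.Relation.Unary.Any using (here; there)
open import Data.List.Relation.Unary.All as All using (All; []; _∷_)
import Data.List.Relation.Unary.All.Properties as All
open import Data.Product using (∃; _×_; _,_)
open import Data.Sum using (inj₁; inj₂)
open import Data.Rational using (ℚ; 0ℚ; 1ℚ; NonZero; _+_; _*_; -_; _-_; 1/_; _≟_; ≢-nonZero)
import Data.Rational.Properties as ℚ
open import Data.Rational.Solver using (module +-*-Solver)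
open import Relation.Binary.PropositionalEquality
  using (_≡_; _≢_; refl; sym; trans; cong; cong₂; module ≡-Reasoning)
open import Relation.Nullary using (Dec; yes; no)
open import Data.Empty using (⊥-elim)
open import Function using (_∘_)

sumℚ-++ : {A : Set} (g : A → ℚ) (xs ys : List A) →
          sumℚ (map g (xs ++ ys)) ≡ sumℚ (map g xs) + sumℚ (map g ys)
sumℚ-++ g []       ys = sym (ℚ.+-identityˡ _)
sumℚ-++ g (x ∷ xs) ys = trans (cong (g x +_) (sumℚ-++ g xs ys)) (sym (ℚ.+-assoc (g x) _ _))

sumℚ-zero : {A : Set} (g : A → ℚ) {xs : List A} → All (λ x → g x ≡ 0ℚ) xs → sumℚ (map g xs) ≡ 0ℚ
sumℚ-zero g []            = refl
sumℚ-zero g (gx≡0 ∷ gxs≡0) = trans (cong₂ _+_ gx≡0 (sumℚ-zero g gxs≡0)) (ℚ.+-identityˡ 0ℚ)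

count-++ : ∀ s xs ys → count s (xs ++ ys) ≡ count s xs ℕ.+ count s ys
count-++ s xs ys = trans (cong length (List.filter-++ (_≟C s) xs ys)) (List.length-++ (filter (_≟C s) xs))

count-∷ : ∀ s v L → count s (v ∷ L) ≡ count s [ v ] ℕ.+ count s L
count-∷ s v L = count-++ s [ v ] L

count-singleton-≢ : ∀ {s v} → v ≢ s → count s [ v ] ≡ 0
count-singleton-≢ {s} {v} v≢s with v ≟C s
... | yes v≡s = ⊥-elim (v≢s v≡s)
... | no  _   = refl

count-singleton-resp : ∀ {s v s′ v′} → (v ≡ s → v′ ≡ s′) → (v′ ≡ s′ → v ≡ s) →
                       count s [ v ] ≡ count s′ [ v′ ]
count-singleton-resp {s} {v} {s′} {v′} to from with v ≟C s | v′ ≟C s′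
... | yes _   | yes _    = refl
... | yes v≡s | no v′≢s′ = ⊥-elim (v′≢s′ (to v≡s))
... | no v≢s  | yes v′≡s′ = ⊥-elim (v≢s (from v′≡s′))
... | no _    | no _     = refl

count-map-injective : ∀ (f : Comp → Comp) → (∀ {t u} → f t ≡ f u → t ≡ u) →
                      ∀ s L → count (f s) (map f L) ≡ count s L
count-map-injective f f-inj s []      = refl
count-map-injective f f-inj s (v ∷ L) = begin
  count (f s) (f v ∷ map f L)                    ≡⟨ count-∷ (f s) (f v) (map f L) ⟩
  count (f s) [ f v ] ℕ.+ count (f s) (map f L)  ≡⟨ cong₂ ℕ._+_ (count-singleton-resp f-inj (cong f))
                                                                (count-map-injective f f-inj s L) ⟩
  count s [ v ] ℕ.+ count s L                    ≡⟨ count-∷ s v L ⟨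
  count s (v ∷ L)                                ∎
  where open ≡-Reasoning

count-map-∉ : ∀ (f : Comp → Comp) s → (∀ t → f t ≢ s) → ∀ L → count s (map f L) ≡ 0
count-map-∉ f s f≢s []      = refl
count-map-∉ f s f≢s (v ∷ L) =
  trans (count-∷ s (f v) (map f L))
        (cong₂ ℕ._+_ (count-singleton-≢ {s} {f v} (f≢s v)) (count-map-∉ f s f≢s L))

count-incHeads-zero : ∀ s L → count (0 ∷ s) (concatMap incHead L) ≡ 0
count-incHeads-zero s []            = refl
count-incHeads-zero s ([] ∷ L)      = count-incHeads-zero s L
count-incHeads-zero s ((a ∷ u) ∷ L) = trans (count-∷ (0 ∷ s) (suc a ∷ u) (concatMap incHead L))
  (cong₂ ℕ._+_ (count-singleton-≢ {0 ∷ s} {suc a ∷ u} (λ ())) (count-incHeads-zero s L))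

count-incHeads-suc : ∀ k s L → count (suc k ∷ s) (concatMap incHead L) ≡ count (k ∷ s) L
count-incHeads-suc k s []            = refl
count-incHeads-suc k s ([] ∷ L)      = count-incHeads-suc k s L
count-incHeads-suc k s ((a ∷ u) ∷ L) = begin
  count (suc k ∷ s) ((suc a ∷ u) ∷ concatMap incHead L)
    ≡⟨ count-∷ (suc k ∷ s) (suc a ∷ u) (concatMap incHead L) ⟩
  count (suc k ∷ s) [ suc a ∷ u ] ℕ.+ count (suc k ∷ s) (concatMap incHead L)
    ≡⟨ cong₂ ℕ._+_ (count-singleton-resp pred-head suc-head) (count-incHeads-suc k s L) ⟩
  count (k ∷ s) [ a ∷ u ] ℕ.+ count (k ∷ s) L
    ≡⟨ count-∷ (k ∷ s) (a ∷ u) L ⟨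
  count (k ∷ s) ((a ∷ u) ∷ L) ∎
  where
  open ≡-Reasoning
  pred-head : suc a ∷ u ≡ suc k ∷ s → a ∷ u ≡ k ∷ s
  pred-head refl = refl
  suc-head : a ∷ u ≡ k ∷ s → suc a ∷ u ≡ suc k ∷ s
  suc-head refl = refl

count-comps-weight : ∀ s → count s (comps (weight s)) ≡ 1
count-comps-∷ : ∀ k s → count (k ∷ s) (comps (weight (k ∷ s))) ≡ 1

count-comps-weight []      = refl
count-comps-weight (k ∷ s) = count-comps-∷ k s

count-comps-∷ zero s = begin
  count (0 ∷ s) (map (0 ∷_) (comps w) ++ concatMap incHead (comps w))
    ≡⟨ count-++ (0 ∷ s) (map (0 ∷_) (comps w)) (concatMap incHead (comps w)) ⟩
  count (0 ∷ s) (map (0 ∷_) (comps w)) ℕ.+ count (0 ∷ s) (concatMap incHead (comps w))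
    ≡⟨ cong₂ ℕ._+_ (count-map-injective (0 ∷_) List.∷-injectiveʳ s (comps w))
                   (count-incHeads-zero s (comps w)) ⟩
  count s (comps w) ℕ.+ 0
    ≡⟨ cong (ℕ._+ 0) (count-comps-weight s) ⟩
  1 ∎
  where
  open ≡-Reasoning
  w = weight s
count-comps-∷ (suc k) s = begin
  count (suc k ∷ s) (map (0 ∷_) (comps w) ++ concatMap incHead (comps w))
    ≡⟨ count-++ (suc k ∷ s) (map (0 ∷_) (comps w)) (concatMap incHead (comps w)) ⟩
  count (suc k ∷ s) (map (0 ∷_) (comps w)) ℕ.+ count (suc k ∷ s) (concatMap incHead (comps w))
    ≡⟨ cong₂ ℕ._+_ (count-map-∉ (0 ∷_) (suc k ∷ s) (λ _ ()) (comps w))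
                   (count-incHeads-suc k s (comps w)) ⟩
  count (k ∷ s) (comps w)
    ≡⟨ count-comps-∷ k s ⟩
  1 ∎
  where
  open ≡-Reasoning
  w = weight (k ∷ s)

∈-count-suc : ∀ {s n} L → count s L ≡ suc n → s ∈ L
∈-count-suc {s} (v ∷ L) count≡suc with v ≟C s
... | yes refl = here refl
... | no  _    = there (∈-count-suc L count≡suc)

∈-comps-weight : ∀ s → s ∈ comps (weight s)
∈-comps-weight s = ∈-count-suc (comps (weight s)) (count-comps-weight s)

module _ (b : Comp → ℚ) (s : Comp) where

  sum-indicator : List Comp → ℚ
  sum-indicator L = sumℚ (map (λ v → b v * ℕtoℚ (count s [ v ])) L)

  sum-indicator-absent : ∀ L → count s L ≡ 0 → sum-indicator L ≡ 0ℚ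
  sum-indicator-absent []      _        = refl
  sum-indicator-absent (v ∷ L) count≡0 with v ≟C s
  ... | no _ = trans (cong₂ _+_ (ℚ.*-zeroʳ (b v)) (sum-indicator-absent L count≡0))
                     (ℚ.+-identityˡ 0ℚ)

  sum-indicator-once : ∀ L → count s L ≡ 1 → sum-indicator L ≡ b s
  sum-indicator-once (v ∷ L) count≡1 with v ≟C s
  ... | yes refl = trans (cong₂ _+_ (ℚ.*-identityʳ (b v))
                                     (sum-indicator-absent L (ℕ.suc-injective count≡1)))
                         (ℚ.+-identityʳ (b v))
  ... | no _     = trans (cong₂ _+_ (ℚ.*-zeroʳ (b v)) (sum-indicator-once L count≡1))
                         (ℚ.+-identityˡ (b s))

scalar : ℚ → H
scalar c []      = c
scalar c (_ ∷ _) = 0ℚ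

scalar-nonempty : ∀ c {u} → u ≢ [] → scalar c u ≡ 0ℚ
scalar-nonempty c {[]}    u≢[] = ⊥-elim (u≢[] refl)
scalar-nonempty c {_ ∷ _} _    = refl

comps-suc-nonempty : ∀ k → All (_≢ []) (comps (suc k))
comps-suc-nonempty k = All.++⁺ (All.map⁺ (All.universal (λ _ ()) (comps k)))
                               (All.concat⁺ (All.map⁺ (All.universal incHead-nonempty (comps k))))
  where
  incHead-nonempty : ∀ u → All (_≢ []) (incHead u)
  incHead-nonempty []      = []
  incHead-nonempty (_ ∷ _) = (λ ()) ∷ []

-- Only the pairs (∅ , v) contribute, and the stuffle of ∅ with v is v itself.
scalar-*H : ∀ c a s → (scalar c *H a) s ≡ c * a s
scalar-*H c a s = begin
  sumℚ (map term (constant-pairs ++ nonconstant-pairs))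
    ≡⟨ sumℚ-++ term constant-pairs nonconstant-pairs ⟩
  sumℚ (map term constant-pairs) + sumℚ (map term nonconstant-pairs)
    ≡⟨ cong₂ _+_ constant-part (sumℚ-zero term nonconstant-part) ⟩
  c * a s + 0ℚ
    ≡⟨ ℚ.+-identityʳ (c * a s) ⟩
  c * a s ∎
  where
  open ≡-Reasoning
  n = weight s

  term : Comp × Comp → ℚ
  term (u , v) = scalar c u * a v * ℕtoℚ (count s (stuffle u v))

  block : ℕ → List (Comp × Comp)
  block k = concatMap (λ u → map (u ,_) (comps (n ∸ k))) (comps k)

  constant-pairs nonconstant-pairs : List (Comp × Comp)
  constant-pairs    = map ([] ,_) (comps n) ++ []
  nonconstant-pairs = concatMap block (applyUpTo suc n)

  constant-part : sumℚ (map term constant-pairs) ≡ c * a s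
  constant-part = begin
    sumℚ (map term constant-pairs)
      ≡⟨ cong (sumℚ ∘ map term) (List.++-identityʳ (map ([] ,_) (comps n))) ⟩
    sumℚ (map term (map ([] ,_) (comps n)))
      ≡⟨ cong sumℚ (List.map-∘ (comps n)) ⟨
    sum-indicator (λ v → c * a v) s (comps n)
      ≡⟨ sum-indicator-once (λ v → c * a v) s (comps n) (count-comps-weight s) ⟩
    c * a s ∎

  term-nonconstant : ∀ {u} → u ≢ [] → ∀ v → term (u , v) ≡ 0ℚ
  term-nonconstant {u} u≢[] v = begin
    scalar c u * a v * q ≡⟨ cong (λ x → x * a v * q) (scalar-nonempty c u≢[]) ⟩
    0ℚ * a v * q         ≡⟨ cong (_* q) (ℚ.*-zeroˡ (a v)) ⟩
    0ℚ * q               ≡⟨ ℚ.*-zeroˡ q ⟩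
    0ℚ                   ∎
    where q = ℕtoℚ (count s (stuffle u v))

  nonconstant-part : All (λ p → term p ≡ 0ℚ) nonconstant-pairs
  nonconstant-part = All.concat⁺ (All.map⁺ (All.applyUpTo⁺₂ suc n λ k →
    All.concat⁺ (All.map⁺ (All.map (λ u≢[] → All.map⁺ (All.universal (term-nonconstant u≢[]) _))
                                   (comps-suc-nonempty k)))))

compsBelow : ℕ → List Comp
compsBelow zero    = []
compsBelow (suc n) = compsBelow n ++ comps n

∈-compsBelow : ∀ {N} s → weight s < N → s ∈ compsBelow N
∈-compsBelow {suc N} s w<1+N with ℕ.m<1+n⇒m<n∨m≡n w<1+N
... | inj₁ w<N  = ∈-++⁺ˡ (∈-compsBelow s w<N)
... | inj₂ refl = ∈-++⁺ʳ (compsBelow N) (∈-comps-weight s)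

compsBelow-prefix : ∀ {m n} → m ≤ n → ∃ λ R → compsBelow n ≡ compsBelow m ++ R
compsBelow-prefix {m} {zero} z≤n = [] , refl
compsBelow-prefix {m} {suc n} m≤1+n with ℕ.m≤n⇒m<n∨m≡n m≤1+n
... | inj₂ refl      = [] , sym (List.++-identityʳ (compsBelow (suc n)))
... | inj₁ (s≤s m≤n) with compsBelow-prefix m≤n
...   | R , eq = R ++ comps n , trans (cong (_++ comps n) eq) (List.++-assoc (compsBelow m) R (comps n))

length-comps-pos : ∀ n → 0 < length (comps n)
length-comps-pos zero    = s≤s z≤n
length-comps-pos (suc n) = ℕ.<-≤-trans (length-comps-pos n) (begin
  length (comps n)                                             ≡⟨ List.length-map (0 ∷_) (comps n) ⟨
  length (map (0 ∷_) (comps n))                                ≤⟨ List.length-++-≤ˡ (map (0 ∷_) (comps n)) ⟩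
  length (map (0 ∷_) (comps n) ++ concatMap incHead (comps n)) ∎)
  where open ℕ.≤-Reasoning

length-compsBelow : ∀ n → n ≤ length (compsBelow n)
length-compsBelow zero    = z≤n
length-compsBelow (suc n) = begin
  suc n                                      ≡⟨ ℕ.+-comm 1 n ⟩
  n ℕ.+ 1                                    ≤⟨ ℕ.+-mono-≤ (length-compsBelow n) (length-comps-pos n) ⟩
  length (compsBelow n) ℕ.+ length (comps n) ≡⟨ List.length-++ (compsBelow n) ⟨
  length (compsBelow (suc n))                ∎
  where open ℕ.≤-Reasoning

-- Indexing with a junk value ∅ past the end of the list.
_!_ : List Comp → ℕ → Comp
[]       ! _     = []
(x ∷ xs) ! zero  = x
(x ∷ xs) ! suc i = xs ! i

!-++ˡ : ∀ xs ys {i} → i < length xs → (xs ++ ys) ! i ≡ xs ! i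
!-++ˡ (x ∷ xs) ys {zero}  _         = refl
!-++ˡ (x ∷ xs) ys {suc i} (s≤s i<n) = !-++ˡ xs ys i<n

∈⇒! : ∀ {s} xs → s ∈ xs → ∃ λ i → i < length xs × xs ! i ≡ s
∈⇒! (x ∷ xs) (here refl) = 0 , s≤s z≤n , refl
∈⇒! (x ∷ xs) (there s∈xs) with ∈⇒! xs s∈xs
... | i , i<n , eq = suc i , s≤s i<n , eq

-- compsBelow (suc i) has more than i entries and is a prefix of every later compsBelow,
-- so enum i is the i-th entry of all of them.
enum : ℕ → Comp
enum i = compsBelow (suc i) ! i

enum-compsBelow : ∀ N {i} → i < length (compsBelow N) → enum i ≡ compsBelow N ! i
enum-compsBelow N {i} i<len with ℕ.≤-total (suc i) N
... | inj₁ 1+i≤N with compsBelow-prefix 1+i≤N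
...   | R , eq = trans (sym (!-++ˡ (compsBelow (suc i)) R (length-compsBelow (suc i))))
                       (cong (_! i) (sym eq))
enum-compsBelow N {i} i<len | inj₂ N≤1+i with compsBelow-prefix N≤1+i
...   | R , eq = trans (cong (_! i) eq) (!-++ˡ (compsBelow N) R i<len)

enum-covers : ∀ N s → weight s < N → ∃ λ i → i < length (compsBelow N) × enum i ≡ s
enum-covers N s w<N with ∈⇒! (compsBelow N) (∈-compsBelow s w<N)
... | i , i<len , eq = i , i<len , trans (enum-compsBelow N i<len) eq

Closure-mono : ∀ {J K : H → Set} → (∀ {y} → J y → K y) → ∀ {x} → Closure J x → Closure K x
Closure-mono J⊆K x∈clJ n with x∈clJ n
... | y , y∈J , x-y∈Iₙ = y , J⊆K y∈J , x-y∈Iₙ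

p-[p/q]*q≡0 : ∀ p q .{{_ : NonZero q}} → p + (- (p * 1/ q)) * q ≡ 0ℚ
p-[p/q]*q≡0 p q = begin
  p + (- (p * 1/ q)) * q   ≡⟨ cong (p +_) (ℚ.neg-distribˡ-* (p * 1/ q) q) ⟨
  p + - (p * 1/ q * q)     ≡⟨ cong (λ r → p + - r) (ℚ.*-assoc p (1/ q) q) ⟩
  p + - (p * (1/ q * q))   ≡⟨ cong (λ r → p + - (p * r)) (ℚ.*-inverseˡ q) ⟩
  p + - (p * 1ℚ)           ≡⟨ cong (λ r → p + - r) (ℚ.*-identityʳ p) ⟩
  p + - p                  ≡⟨ ℚ.+-inverseʳ p ⟩
  0ℚ                       ∎
  where open ≡-Reasoning

add-subtract : ∀ y z c a → y + z ≡ (y + c * a) + (z + (- c) * a)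
add-subtract = solve 4 (λ y z c a → y :+ z := (y :+ c :* a) :+ (z :+ (:- c) :* a)) refl
  where open +-*-Solver

module Elimination (em : ExcludedMiddle 0ℓ) {I : H → Set} (ideal : IsIdeal I) where
  open IsIdeal ideal

  VanishesBelow : ℕ → H → Set
  VanishesBelow j z = ∀ i → i < j → z (enum i) ≡ 0ℚ

  Pivot : ℕ → H → Set
  Pivot j z = I z × VanishesBelow j z × z (enum j) ≢ 0ℚ

  pivotOrZero : ∀ j → Dec (∃ (Pivot j)) → H
  pivotOrZero j (yes (z , _)) = z
  pivotOrZero j (no _)        = zeroH

  α : ℕ → H
  α j = pivotOrZero j em

  pivotOrZero-∈ : ∀ j d → I (pivotOrZero j d)
  pivotOrZero-∈ j (yes (_ , z∈I , _)) = z∈I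
  pivotOrZero-∈ j (no _)              = zero∈

  pivotOrZero-vanishes : ∀ j d → VanishesBelow j (pivotOrZero j d)
  pivotOrZero-vanishes j (yes (_ , _ , vz , _)) = vz
  pivotOrZero-vanishes j (no _)                 = λ _ _ → refl

  pivotOrZero-pivot : ∀ j d {z} → Pivot j z → pivotOrZero j d (enum j) ≢ 0ℚ
  pivotOrZero-pivot j (yes (_ , _ , _ , z≢0)) _     = z≢0
  pivotOrZero-pivot j (no ∄pivot)             pivot = ⊥-elim (∄pivot (_ , pivot))

  Gen⊆I : ∀ {y} → Gen α y → I y
  Gen⊆I (gen j)   = pivotOrZero-∈ j em
  Gen⊆I zer       = zero∈
  Gen⊆I (add p q) = +∈ (Gen⊆I p) (Gen⊆I q)
  Gen⊆I (mul r p) = *∈ r (Gen⊆I p)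

  α-tends-to-zero : TendsToZero α
  α-tends-to-zero N = length (compsBelow N) , λ n M≤n s w<N → α-vanishes n M≤n (enum-covers N s w<N)
    where
    α-vanishes : ∀ n → length (compsBelow N) ≤ n →
                 ∀ {s} → (∃ λ i → i < length (compsBelow N) × enum i ≡ s) → α n s ≡ 0ℚ
    α-vanishes n M≤n (i , i<M , refl) = pivotOrZero-vanishes n em i (ℕ.<-≤-trans i<M M≤n)

  vanishesBelow-suc : ∀ {j} z → VanishesBelow j z → z (enum j) ≡ 0ℚ → VanishesBelow (suc j) z
  vanishesBelow-suc z vz zj≡0 i i<1+j with ℕ.m<1+n⇒m<n∨m≡n i<1+j
  ... | inj₁ i<j  = vz i i<j
  ... | inj₂ refl = zj≡0

  vanishesBelow-+scalar*H : ∀ {j} z a c → VanishesBelow j z → VanishesBelow j a →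
                            VanishesBelow j (z +H (scalar c *H a))
  vanishesBelow-+scalar*H z a c vz va i i<j = begin
    z (enum i) + (scalar c *H a) (enum i) ≡⟨ cong₂ _+_ (vz i i<j) (scalar-*H c a (enum i)) ⟩
    0ℚ + c * a (enum i)                  ≡⟨ cong (λ r → 0ℚ + c * r) (va i i<j) ⟩
    0ℚ + c * 0ℚ                          ≡⟨ cong (0ℚ +_) (ℚ.*-zeroʳ c) ⟩
    0ℚ                                   ∎
    where open ≡-Reasoning

  record Reduction (x : H) (j : ℕ) : Set where
    field
      y          : H
      y∈Gen      : Gen α y
      z          : H
      z∈I        : I z
      z-vanishes : VanishesBelow j z
      x≗y+z      : ∀ s → x s ≡ y s + z s

  reduce : ∀ {x j} → Reduction x j → Reduction x (suc j)
  reduce {x} {j} r with Reduction.z r (enum j) ≟ 0ℚ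
  ... | yes zj≡0 = record
    { y = y ; y∈Gen = y∈Gen ; z = z ; z∈I = z∈I
    ; z-vanishes = vanishesBelow-suc z z-vanishes zj≡0
    ; x≗y+z = x≗y+z }
    where open Reduction r
  ... | no zj≢0 = record
    { y          = y +H (scalar c *H a)
    ; y∈Gen      = add y∈Gen (mul (scalar c) (gen j))
    ; z          = z +H (scalar (- c) *H a)
    ; z∈I        = +∈ z∈I (*∈ (scalar (- c)) (pivotOrZero-∈ j em))
    ; z-vanishes = vanishesBelow-suc (z +H (scalar (- c) *H a))
        (vanishesBelow-+scalar*H z a (- c) z-vanishes (pivotOrZero-vanishes j em))
        (trans (cong (z e +_) (scalar-*H (- c) a e)) (p-[p/q]*q≡0 (z e) (a e)))
    ; x≗y+z      = λ s → begin
        x s                                            ≡⟨ x≗y+z s ⟩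
        y s + z s                                      ≡⟨ add-subtract (y s) (z s) c (a s) ⟩
        (y s + c * a s) + (z s + (- c) * a s)          ≡⟨ cong₂ (λ p q → (y s + p) + (z s + q))
                                                                (scalar-*H c a s) (scalar-*H (- c) a s) ⟨
        (y s + (scalar c *H a) s) + (z s + (scalar (- c) *H a) s) ∎
    }
    where
    open Reduction r
    open ≡-Reasoning
    a = α j
    e = enum j
    instance
      aₑ≢0 : NonZero (a e)
      aₑ≢0 = ≢-nonZero (pivotOrZero-pivot j em (z∈I , z-vanishes , zj≢0))
    c : ℚ
    c = z e * 1/ a e

  reduction : ∀ {x} → I x → ∀ j → Reduction x j
  reduction {x} x∈I zero    = record
    { y = zeroH ; y∈Gen = zer ; z = x ; z∈I = x∈I ; z-vanishes = λ _ ()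
    ; x≗y+z = λ s → sym (ℚ.+-identityˡ (x s)) }
  reduction     x∈I (suc j) = reduce (reduction x∈I j)

  α-approximates : ∀ {x} → I x → Closure (Gen α) x
  α-approximates {x} x∈I N = y , y∈Gen , λ s w<N → residue-vanishes (enum-covers N s w<N)
    where
    open Reduction (reduction x∈I (length (compsBelow N)))
    open ≡-Reasoning
    residue-vanishes : ∀ {s} → (∃ λ i → i < length (compsBelow N) × enum i ≡ s) →
                       x s - y s ≡ 0ℚ
    residue-vanishes (i , i<M , refl) = let e = enum i in begin
      x e - y e            ≡⟨ cong (_- y e) (x≗y+z e) ⟩
      (y e + z e) - y e    ≡⟨ cong (λ r → (y e + r) - y e) (z-vanishes i i<M) ⟩
      (y e + 0ℚ) - y e     ≡⟨ cong (_- y e) (ℚ.+-identityʳ (y e)) ⟩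
      y e - y e            ≡⟨ ℚ.+-inverseʳ (y e) ⟩
      0ℚ                   ∎

proposition2 : ExcludedMiddle 0ℓ → (I : H → Set) → IsClosedIdeal I →
    ∃ λ (α : ℕ → H) → (∀ n → I (α n)) × TendsToZero α ×
      (∀ x → (I x → Closure (Gen α) x) × (Closure (Gen α) x → I x))
proposition2 em I (ideal , closed) =
  α , (λ j → pivotOrZero-∈ j em) , α-tends-to-zero ,
  λ x → α-approximates , λ x∈closure → closed x (Closure-mono Gen⊆I {x} x∈closure)
  where open Elimination em ideal
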